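{- Let $p$ be a segmented partially ordered pattern. Then $B^p_q(x)=(x-1)A^p_q(x)+1$.
   Context: A partially ordered pattern (POP) of length $m$ is a word $p=p_1\cdots p_m$ of distinct elements of a poset; it is segmented (SPOP) if occurrences must be consecutive: an occurrence of $p$ in a permutation $\pi=\pi_1\cdots\pi_n$ is a factor $\pi_i\pi_{i+1}\cdots\pi_{i+m-1}$ such that $\pi_{i+s-1}<\pi_{i+t-1}$ whenever $p_s<p_t$ in the poset. A permutation avoids $p$ if it has no occurrence of $p$, and quasi-avoids $p$ if it has exactly one occurrence of $p$ and that occurrence consists of its $m$ rightmost letters. $\mathrm{inv}(\pi)$ is the number of pairs $i<j$ with $\pi_i>\pi_j$. $[n]_q=1+q+\cdots+q^{n-1}$, $[n]_q!=[n]_q[n-1]_q\cdots[1]_q$ ($[0]_q!=1$). $A^p_q(x)=\sum_{\pi}q^{\mathrm{inv}(\pi)}x^{|\pi|}/[|\pi|]_q!$, the sum over all permutations $\pi$ of all lengths $n\ge0$ (including the empty one) that avoid $p$, and $B^p_q(x)$ is the same sum over all permutations that quasi-avoid $p$. -}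

module Defs where

open import Level using (Level; 0ℓ)
open import Data.Nat using (ℕ; zero; suc; _+_; _∸_; _≤_; _<_; _<?_; _≤?_)
open import Data.Nat.Properties using (_≟_)
open import Data.Fin using (Fin; toℕ)
open import Data.Fin.Properties using (all?) renaming (_≟_ to _≟ᶠ_)
open import Data.Vec using (Vec; []; _∷_; lookup; toList)
import Data.Vec as Vec
open import Data.List using (List; []; _∷_; length; filter; map; foldr; upTo; concatMap; cartesianProduct; allFin)
open import Data.Product using (_×_; _,_)
open import Relation.Binary using (Rel; Decidable)
open import Relation.Binary.PropositionalEquality using (_≡_)
open import Relation.Nullary using (Dec; _×-dec_; _→-dec_)
open import Algebra.Bundles using (CommutativeRing)

-- Permutations of length n: words π = π₁⋯πₙ over {0,…,n-1}, stored as
-- Vec (Fin n) n, which are injective (hence bijective).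

allWords : (k n : ℕ) → List (Vec (Fin k) n)
allWords k zero    = [] ∷ []
allWords k (suc n) = concatMap (λ w → map (λ a → a ∷ w) (allFin k)) (allWords k n)

IsPerm : ∀ {n} → Vec (Fin n) n → Set
IsPerm {n} v = ∀ (i j : Fin n) → lookup v i ≡ lookup v j → i ≡ j

isPerm? : ∀ {n} (v : Vec (Fin n) n) → Dec (IsPerm v)
isPerm? v = all? (λ i → all? (λ j → (lookup v i ≟ᶠ lookup v j) →-dec (i ≟ᶠ j)))

perms : (n : ℕ) → List (Vec (Fin n) n)
perms n = filter isPerm? (allWords n n)

-- nth element of a list (0-based), default 0 out of range
nth : List ℕ → ℕ → ℕ
nth []       _       = 0
nth (x ∷ xs) zero    = x
nth (x ∷ xs) (suc j) = nth xs j

-- the letter of π at 0-based position j (only used for j < n)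
val : ∀ {n} → Vec (Fin n) n → ℕ → ℕ
val π j = nth (toList (Vec.map toℕ π)) j

inv : ∀ {n} → Vec (Fin n) n → ℕ
inv {n} π = length (filter (λ { (i , j) → (i <? j) ×-dec (val π j <? val π i) })
                           (cartesianProduct (upTo n) (upTo n)))

-- A SPOP p = p₁⋯pₘ of distinct poset elements is determined (for the
-- purpose of occurrences) by the strict order it induces on positions:
-- s ≺ t iff p_{s+1} < p_{t+1} in the poset.

module Pattern (m : ℕ) (_≺_ : Rel (Fin m) 0ℓ) (_≺?_ : Decidable _≺_) where

  -- the factor of π starting at 0-based position i is an occurrence of p
  -- (the condition i + m ≤ n is imposed by `occurrences` below)
  OccursAt : ∀ {n} → Vec (Fin n) n → ℕ → Set
  OccursAt π i = ∀ (s t : Fin m) → s ≺ t → val π (i + toℕ s) < val π (i + toℕ t)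

  occursAt? : ∀ {n} (π : Vec (Fin n) n) (i : ℕ) → Dec (OccursAt π i)
  occursAt? π i = all? (λ s → all? (λ t →
                    (s ≺? t) →-dec (val π (i + toℕ s) <? val π (i + toℕ t))))

  occurrences : ∀ {n} → Vec (Fin n) n → List ℕ
  occurrences {n} π = filter (occursAt? π) (upTo (suc n ∸ m))

  Avoids : ∀ {n} → Vec (Fin n) n → Set
  Avoids π = length (occurrences π) ≡ 0

  avoids? : ∀ {n} (π : Vec (Fin n) n) → Dec (Avoids π)
  avoids? π = length (occurrences π) ≟ 0

  QuasiAvoids : ∀ {n} → Vec (Fin n) n → Set
  QuasiAvoids {n} π = (length (occurrences π) ≡ 1) × (m ≤ n) × OccursAt π (n ∸ m)

  quasiAvoids? : ∀ {n} (π : Vec (Fin n) n) → Dec (QuasiAvoids π)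
  quasiAvoids? {n} π = (length (occurrences π) ≟ 1) ×-dec ((m ≤? n) ×-dec occursAt? π (n ∸ m))

  module Coefficients {c ℓ : Level} (R : CommutativeRing c ℓ) (q : CommutativeRing.Carrier R) where
    open CommutativeRing R using (Carrier; 1#; 0#) renaming (_+_ to _⊕_; _*_ to _⊛_)

    pow : Carrier → ℕ → Carrier
    pow x zero    = 1#
    pow x (suc k) = x ⊛ pow x k

    sumR : List Carrier → Carrier
    sumR = foldr _⊕_ 0#

    qInt : ℕ → Carrier
    qInt n = sumR (map (pow q) (upTo n))

    qFact : ℕ → Carrier
    qFact zero    = 1#
    qFact (suc n) = qInt (suc n) ⊛ qFact n

    -- a n = Σ_{π ∈ S_n, π avoids p} q^{inv π}
    --   (so A^p_q(x) = Σ_n a n · x^n / [n]_q!)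
    a : ℕ → Carrier
    a n = sumR (map (λ π → pow q (inv π)) (filter avoids? (perms n)))

    -- b n = Σ_{π ∈ S_n, π quasi-avoids p} q^{inv π}
    --   (so B^p_q(x) = Σ_n b n · x^n / [n]_q!)
    b : ℕ → Carrier
    b n = sumR (map (λ π → pow q (inv π)) (filter quasiAvoids? (perms n)))

-- Deleting the last letter j of a permutation π of length n + 1 and standardising the rest
-- gives a permutation σ of length n, and π ↦ (σ , j) is a bijection S(n+1) ≅ S(n) × [0, n]
-- under which inv π = inv σ + (n − j).  As p is segmented and standardisation preserves
-- relative order, the occurrences of p in π are those of σ plus possibly one in the last
-- m letters; hence π avoids or quasi-avoids p exactly when σ avoids p.  Summing q^inv over
-- both sides gives b(n+1) + a(n+1) = [n+1]_q a(n), and b(0) + a(0) = 1 because the empty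
-- permutation does one or the other; this is B = (x − 1) A + 1 read off coefficientwise.

module Submission where

open import Defs
open import Level using (Level; 0ℓ)
open import Data.Nat using (ℕ; zero; suc; _+_; _∸_; _≤_; _<_; _<?_; _≤?_; z≤n; s≤s; s≤s⁻¹)
open import Data.Nat.Properties
open import Data.Fin using (Fin; toℕ; zero; suc; fromℕ<; punchIn; punchOut)
open import Data.Fin.Properties
  using (toℕ-injective; toℕ<n; fromℕ<-injective; punchIn-injective; punchIn-punchOut)
open import Data.Vec using (Vec; []; _∷_; _∷ʳ_; lookup; toList; initLast)
import Data.Vec as Vec
open import Data.Vec.Properties
  using (∷-injectiveˡ; ∷-injectiveʳ; ∷ʳ-injective; tabulate-∘; tabulate-cong; tabulate∘lookup)
open import Data.List
  using (List; []; _∷_; [_]; _++_; length; filter; map; upTo; allFin; concatMap;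
         cartesianProduct; cartesianProductWith)
import Data.List as List
open import Data.List.Properties
  using (map-++; ++-assoc; length-++; upTo-∷ʳ; map-tabulate; cartesianProductWith-distribʳ-++;
         filter-++; filter-all; filter-none; filter-accept; filter-reject)
open import Data.List.Membership.Propositional using (_∈_)
open import Data.List.Membership.Propositional.Properties
  using (∈-cartesianProductWith⁺; ∈-cartesianProductWith⁻; ∈-allFin; ∈-filter⁺; ∈-filter⁻)
open import Data.List.Membership.Propositional.Properties.WithK using (unique∧set⇒bag)
open import Data.List.Relation.Unary.Any using (here)
open import Data.List.Relation.Unary.All as All using (All; []; _∷_)
import Data.List.Relation.Unary.All.Properties as All⁺
import Data.List.Relation.Unary.AllPairs as AllPairs
open import Data.List.Relation.Unary.Unique.Propositional using (Unique)
import Data.List.Relation.Unary.Unique.Propositional.Properties as Unique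
open import Data.List.Relation.Binary.BagAndSetEquality using (∼bag⇒↭)
open import Data.List.Relation.Binary.Permutation.Propositional
  using (_↭_; prep; ↭-sym; ↭-reflexive; ↭-trans; ↭⇒↭ₛ′; module PermutationReasoning)
open import Data.List.Relation.Binary.Permutation.Propositional.Properties
  using (map⁺; ↭-length; filter-↭; shift; ++⁺ˡ)
open import Data.List.Relation.Binary.Permutation.Setoid.Properties using (foldr-commMonoid)
open import Data.Product using (_×_; _,_; proj₁; proj₂; ∃₂)
open import Data.Sum using (_⊎_; inj₁; inj₂)
open import Function using (id; _∘_; _⇔_; mk⇔; Equivalence; Injective)
open import Function.Construct.Symmetry using (⇔-sym)
open import Relation.Binary using (Rel; Decidable; IsStrictPartialOrder)
open import Relation.Binary.PropositionalEquality
  using (_≡_; _≢_; refl; sym; trans; cong; cong₂; subst; subst₂; module ≡-Reasoning)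
open import Relation.Nullary using (Dec; yes; no; ¬_; contradiction; _×-dec_; _⊎-dec_)
import Relation.Unary as U
open import Algebra.Bundles using (CommutativeRing)

open Equivalence using (to; from)

private
  variable
    ℓ₁ ℓ₂ ℓ₃ p q : Level
    A : Set ℓ₁
    B : Set ℓ₂
    C : Set ℓ₃

cartesianProduct-∷ʳ : ∀ (xs : List A) (ys : List B) y →
                      cartesianProduct xs (ys ++ [ y ]) ↭ cartesianProduct xs ys ++ map (_, y) xs
cartesianProduct-∷ʳ []       ys y = ↭-reflexive refl
cartesianProduct-∷ʳ (x ∷ xs) ys y = begin
  map (x ,_) (ys ++ [ y ]) ++ cartesianProduct xs (ys ++ [ y ])
    ≡⟨ cong (_++ cartesianProduct xs (ys ++ [ y ])) (map-++ (x ,_) ys [ y ]) ⟩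
  (map (x ,_) ys ++ [ x , y ]) ++ cartesianProduct xs (ys ++ [ y ])
    ≡⟨ ++-assoc (map (x ,_) ys) [ x , y ] _ ⟩
  map (x ,_) ys ++ (x , y) ∷ cartesianProduct xs (ys ++ [ y ])
    ↭⟨ ++⁺ˡ (map (x ,_) ys) (prep (x , y) (cartesianProduct-∷ʳ xs ys y)) ⟩
  map (x ,_) ys ++ (x , y) ∷ cartesianProduct xs ys ++ map (_, y) xs
    ↭⟨ ++⁺ˡ (map (x ,_) ys) (↭-sym (shift (x , y) (cartesianProduct xs ys) _)) ⟩
  map (x ,_) ys ++ cartesianProduct xs ys ++ (x , y) ∷ map (_, y) xs
    ≡⟨ ++-assoc (map (x ,_) ys) (cartesianProduct xs ys) _ ⟨
  (map (x ,_) ys ++ cartesianProduct xs ys) ++ (x , y) ∷ map (_, y) xs ∎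
  where open PermutationReasoning

filter-⊎-↭ : ∀ {P : U.Pred A p} {Q : U.Pred A q} (P? : U.Decidable P) (Q? : U.Decidable Q) →
             (∀ {x} → P x → ¬ Q x) →
             ∀ xs → filter (λ x → P? x ⊎-dec Q? x) xs ↭ filter P? xs ++ filter Q? xs
filter-⊎-↭ P? Q? disjoint []       = ↭-reflexive refl
filter-⊎-↭ P? Q? disjoint (x ∷ xs) with P? x | Q? x
... | yes Px | yes Qx = contradiction Qx (disjoint Px)
... | yes _  | no  _  = prep x (filter-⊎-↭ P? Q? disjoint xs)
... | no  _  | yes _  =
  ↭-trans (prep x (filter-⊎-↭ P? Q? disjoint xs)) (↭-sym (shift x (filter P? xs) (filter Q? xs)))
... | no  _  | no  _  = filter-⊎-↭ P? Q? disjoint xs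

filter-cartesianProductWith : ∀ {P : U.Pred C p} {Q : U.Pred A q} (P? : U.Decidable P) (Q? : U.Decidable Q)
                              (g : A → B → C) → (∀ x y → Q x ⇔ P (g x y)) → ∀ xs ys →
                              filter P? (cartesianProductWith g xs ys)
                              ≡ cartesianProductWith g (filter Q? xs) ys
filter-cartesianProductWith P? Q? g Q⇔P []       ys = refl
filter-cartesianProductWith P? Q? g Q⇔P (x ∷ xs) ys
  rewrite filter-++ P? (map (g x) ys) (cartesianProductWith g xs ys)
        | filter-cartesianProductWith P? Q? g Q⇔P xs ys
  with Q? x
... | yes Qx = cong (_++ _) (filter-all P? (All⁺.map⁺ (All.universal (λ y → to (Q⇔P x y) Qx) ys)))
... | no ¬Qx = cong (_++ _) (filter-none P? (All⁺.map⁺ (All.universal (λ y → ¬Qx ∘ from (Q⇔P x y)) ys)))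

map-injective : ∀ {f : A → B} → Injective _≡_ _≡_ f →
                ∀ {l} → Injective _≡_ _≡_ (Vec.map {n = l} f)
map-injective f-inj {x = []}     {[]}     _  = refl
map-injective f-inj {x = x ∷ xs} {y ∷ ys} eq =
  cong₂ _∷_ (f-inj (∷-injectiveˡ eq)) (map-injective f-inj (∷-injectiveʳ eq))

count : ∀ {P : U.Pred A p} → U.Decidable P → List A → ℕ
count P? xs = length (filter P? xs)

module _ {P : U.Pred A p} (P? : U.Decidable P) where

  count-++ : ∀ xs ys → count P? (xs ++ ys) ≡ count P? xs + count P? ys
  count-++ xs ys = trans (cong length (filter-++ P? xs ys)) (length-++ (filter P? xs))

  count-↭ : ∀ {xs ys} → xs ↭ ys → count P? xs ≡ count P? ys
  count-↭ xs↭ys = ↭-length (filter-↭ P? xs↭ys)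

  count-none : ∀ {xs} → All (¬_ ∘ P) xs → count P? xs ≡ 0
  count-none ¬Pxs = cong length (filter-none P? ¬Pxs)

  count-[x]-accept : ∀ {x} → P x → count P? [ x ] ≡ 1
  count-[x]-accept Px = cong length (filter-accept P? Px)

  count-[x]-reject : ∀ {x} → ¬ P x → count P? [ x ] ≡ 0
  count-[x]-reject ¬Px = cong length (filter-reject P? ¬Px)

  count-map : ∀ (f : B → A) xs → count P? (map f xs) ≡ count (P? ∘ f) xs
  count-map f []       = refl
  count-map f (x ∷ xs) with P? (f x)
  ... | yes _ = cong suc (count-map f xs)
  ... | no  _ = count-map f xs

  count-cong : ∀ {Q : U.Pred A q} (Q? : U.Decidable Q) {xs} →
               All (λ x → P x ⇔ Q x) xs → count P? xs ≡ count Q? xs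
  count-cong Q? []                   = refl
  count-cong Q? {x ∷ xs} (Px⇔Qx ∷ eqs) with P? x | Q? x
  ... | yes _  | yes _  = cong suc (count-cong Q? eqs)
  ... | no  _  | no  _  = count-cong Q? eqs
  ... | yes Px | no ¬Qx = contradiction (to Px⇔Qx Px) ¬Qx
  ... | no ¬Px | yes Qx = contradiction (from Px⇔Qx Qx) ¬Px

count-upTo-cong : ∀ {P : U.Pred ℕ p} {Q : U.Pred ℕ q} (P? : U.Decidable P) (Q? : U.Decidable Q) n →
                  (∀ {i} → i < n → P i ⇔ Q i) → count P? (upTo n) ≡ count Q? (upTo n)
count-upTo-cong P? Q? n P⇔Q = count-cong P? Q? (All.map P⇔Q (All⁺.all-upTo n))

count-upTo-suc : ∀ {P : U.Pred ℕ p} (P? : U.Decidable P) n →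
                 count P? (upTo (suc n)) ≡ count P? (upTo n) + count P? [ n ]
count-upTo-suc P? n = trans (cong (count P?) (sym (upTo-∷ʳ n))) (count-++ P? (upTo n) [ n ])

-- Inversions

SameOrderBelow : ℕ → (ℕ → ℕ) → (ℕ → ℕ) → Set
SameOrderBelow n v w = ∀ {i j} → i < n → j < n → (v i < v j) ⇔ (w i < w j)

Inversion : (ℕ → ℕ) → U.Pred (ℕ × ℕ) 0ℓ
Inversion v (i , j) = i < j × v j < v i

inversion? : ∀ v → U.Decidable (Inversion v)
inversion? v (i , j) = (i <? j) ×-dec (v j <? v i)

inversions : (ℕ → ℕ) → ℕ → ℕ
inversions v n = count (inversion? v) (cartesianProduct (upTo n) (upTo n))

inv-inversions : ∀ {n} (π : Vec (Fin n) n) → inv π ≡ inversions (val π) n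
inv-inversions π = refl

inversions-suc : ∀ v n → inversions v (suc n) ≡ inversions v n + count (λ i → v n <? v i) (upTo n)
inversions-suc v n = begin
  count I? (cartesianProduct (upTo (suc n)) (upTo (suc n)))
    ≡⟨ cong (λ xs → count I? (cartesianProduct xs (upTo (suc n)))) (upTo-∷ʳ n) ⟨
  count I? (cartesianProduct (upTo n ++ [ n ]) (upTo (suc n)))
    ≡⟨ cong (count I?) (cartesianProductWith-distribʳ-++ _,_ (upTo n) [ n ] (upTo (suc n))) ⟩
  count I? (cartesianProduct (upTo n) (upTo (suc n)) ++ cartesianProduct [ n ] (upTo (suc n)))
    ≡⟨ count-++ I? (cartesianProduct (upTo n) (upTo (suc n))) _ ⟩
  count I? (cartesianProduct (upTo n) (upTo (suc n))) + count I? (cartesianProduct [ n ] (upTo (suc n)))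
    ≡⟨ cong₂ _+_ (cong (count I? ∘ cartesianProduct (upTo n)) (upTo-∷ʳ n))
                 (sym (count-none I? noneFromLast)) ⟨
  count I? (cartesianProduct (upTo n) (upTo n ++ [ n ])) + 0
    ≡⟨ +-identityʳ _ ⟩
  count I? (cartesianProduct (upTo n) (upTo n ++ [ n ]))
    ≡⟨ count-↭ I? (cartesianProduct-∷ʳ (upTo n) (upTo n) n) ⟩
  count I? (cartesianProduct (upTo n) (upTo n) ++ map (_, n) (upTo n))
    ≡⟨ count-++ I? (cartesianProduct (upTo n) (upTo n)) _ ⟩
  inversions v n + count I? (map (_, n) (upTo n))
    ≡⟨ cong (inversions v n +_) (count-map I? (_, n) (upTo n)) ⟩
  inversions v n + count (I? ∘ (_, n)) (upTo n)
    ≡⟨ cong (inversions v n +_) (count-upTo-cong _ _ n (λ i<n → mk⇔ proj₂ (i<n ,_))) ⟩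
  inversions v n + count (λ i → v n <? v i) (upTo n) ∎
  where
  open ≡-Reasoning
  I? = inversion? v
  noneFromLast : All (¬_ ∘ Inversion v) (cartesianProduct [ n ] (upTo (suc n)))
  noneFromLast = All⁺.++⁺ (All⁺.map⁺ (All.map (λ j<1+n n<j×_ → <⇒≱ (proj₁ n<j×_) (s≤s⁻¹ j<1+n))
                                              (All⁺.all-upTo (suc n)))) []

inversions-cong : ∀ {v w} n → SameOrderBelow n v w → inversions v n ≡ inversions w n
inversions-cong zero    v≅w = refl
inversions-cong {v} {w} (suc n) v≅w = begin
  inversions v (suc n)                                 ≡⟨ inversions-suc v n ⟩
  inversions v n + count (λ i → v n <? v i) (upTo n)
    ≡⟨ cong₂ _+_ (inversions-cong n (λ i<n j<n → v≅w (m<n⇒m<1+n i<n) (m<n⇒m<1+n j<n)))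
                 (count-upTo-cong _ _ n (λ i<n → v≅w (n<1+n n) (m<n⇒m<1+n i<n))) ⟩
  inversions w n + count (λ i → w n <? w i) (upTo n)   ≡⟨ inversions-suc w n ⟨
  inversions w (suc n) ∎
  where open ≡-Reasoning

-- Extending a permutation by a last letter

punchℕ : ℕ → ℕ → ℕ
punchℕ zero    x       = suc x
punchℕ (suc k) zero    = zero
punchℕ (suc k) (suc x) = suc (punchℕ k x)

toℕ-punchIn : ∀ {n} (j : Fin (suc n)) (x : Fin n) → toℕ (punchIn j x) ≡ punchℕ (toℕ j) (toℕ x)
toℕ-punchIn zero     x        = refl
toℕ-punchIn (suc j) zero     = refl
toℕ-punchIn (suc j) (suc x) = cong suc (toℕ-punchIn j x)

punchℕ-< : ∀ {k x} → x < k → punchℕ k x ≡ x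
punchℕ-< {suc k} {zero}  _   = refl
punchℕ-< {suc k} {suc x} x<k = cong suc (punchℕ-< (s≤s⁻¹ x<k))

punchℕ-≥ : ∀ {k x} → k ≤ x → punchℕ k x ≡ suc x
punchℕ-≥ {zero}  {x}     _   = refl
punchℕ-≥ {suc k} {suc x} k≤x = cong suc (punchℕ-≥ (s≤s⁻¹ k≤x))

punchℕ-≢ : ∀ k x → punchℕ k x ≢ k
punchℕ-≢ (suc k) (suc x) eq = punchℕ-≢ k x (suc-injective eq)

punchℕ-injective : ∀ k {x y} → punchℕ k x ≡ punchℕ k y → x ≡ y
punchℕ-injective zero    eq = suc-injective eq
punchℕ-injective (suc k) {zero}  {zero}  _  = refl
punchℕ-injective (suc k) {suc x} {suc y} eq = cong suc (punchℕ-injective k (suc-injective eq))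

punchℕ-mono-< : ∀ k {x y} → x < y → punchℕ k x < punchℕ k y
punchℕ-mono-< zero    x<y = s≤s x<y
punchℕ-mono-< (suc k) {zero}  {suc y} _   = s≤s z≤n
punchℕ-mono-< (suc k) {suc x} {suc y} x<y = s≤s (punchℕ-mono-< k (s≤s⁻¹ x<y))

punchℕ-cancel-< : ∀ k {x y} → punchℕ k x < punchℕ k y → x < y
punchℕ-cancel-< zero    p<q = s≤s⁻¹ p<q
punchℕ-cancel-< (suc k) {zero}  {suc y} _   = s≤s z≤n
punchℕ-cancel-< (suc k) {suc x} {suc y} p<q = s≤s (punchℕ-cancel-< k (s≤s⁻¹ p<q))

≤-punchℕ : ∀ {j k} x → j ≤ k → j ≤ punchℕ k x ⇔ j ≤ x
≤-punchℕ {j} {k} x j≤k with x <? k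
... | yes x<k = mk⇔ (subst (j ≤_) (punchℕ-< x<k)) (subst (j ≤_) (sym (punchℕ-< x<k)))
... | no  x≮k = mk⇔ (λ _ → ≤-trans j≤k (≮⇒≥ x≮k))
                    (λ j≤x → subst (j ≤_) (sym (punchℕ-≥ (≮⇒≥ x≮k))) (m≤n⇒m≤1+n j≤x))

<-punchℕ : ∀ {j k} x → k ≤ j → j < punchℕ k x ⇔ j ≤ x
<-punchℕ {j} {k} x k≤j with x <? k
... | yes x<k = mk⇔ (λ j<p → contradiction (<-trans j<p (subst (_< k) (sym (punchℕ-< x<k)) x<k)) (≤⇒≯ k≤j))
                    (λ j≤x → contradiction (≤-<-trans (≤-trans k≤j j≤x) x<k) (<-irrefl refl))
... | no  x≮k = mk⇔ (λ j<p → s≤s⁻¹ (subst (j <_) (punchℕ-≥ (≮⇒≥ x≮k)) j<p))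
                    (λ j≤x → subst (j <_) (sym (punchℕ-≥ (≮⇒≥ x≮k))) (s≤s j≤x))

-- val for vectors of any shape; val π and letter π are definitionally equal.
letter : ∀ {k l} → Vec (Fin k) l → ℕ → ℕ
letter v = nth (toList (Vec.map toℕ v))

letter-lookup : ∀ {k l} (v : Vec (Fin k) l) i → letter v (toℕ i) ≡ toℕ (lookup v i)
letter-lookup (x ∷ v) zero    = refl
letter-lookup (x ∷ v) (suc i) = letter-lookup v i

letter-fromℕ< : ∀ {k l} (v : Vec (Fin k) l) {i} (i<l : i < l) → letter v i ≡ toℕ (lookup v (fromℕ< i<l))
letter-fromℕ< (x ∷ v) {zero}  _    = refl
letter-fromℕ< (x ∷ v) {suc i} i<l = letter-fromℕ< v (s≤s⁻¹ i<l)

letter-∷ʳ-< : ∀ {k l} (v : Vec (Fin k) l) x {i} → i < l → letter (v ∷ʳ x) i ≡ letter v i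
letter-∷ʳ-< (y ∷ v) x {zero}  _   = refl
letter-∷ʳ-< (y ∷ v) x {suc i} i<l = letter-∷ʳ-< v x (s≤s⁻¹ i<l)

letter-∷ʳ-last : ∀ {k l} (v : Vec (Fin k) l) x → letter (v ∷ʳ x) l ≡ toℕ x
letter-∷ʳ-last []      x = refl
letter-∷ʳ-last (y ∷ v) x = letter-∷ʳ-last v x

letter-map-punchIn : ∀ {k l} (j : Fin (suc k)) (v : Vec (Fin k) l) {i} → i < l →
                     letter (Vec.map (punchIn j) v) i ≡ punchℕ (toℕ j) (letter v i)
letter-map-punchIn j (x ∷ v) {zero}  _   = toℕ-punchIn j x
letter-map-punchIn j (x ∷ v) {suc i} i<l = letter-map-punchIn j v (s≤s⁻¹ i<l)

extend : ∀ {n} → Vec (Fin n) n → Fin (suc n) → Vec (Fin (suc n)) (suc n)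
extend σ j = Vec.map (punchIn j) σ ∷ʳ j

extend-injective : ∀ {n} {σ τ : Vec (Fin n) n} {j k} → extend σ j ≡ extend τ k → σ ≡ τ × j ≡ k
extend-injective {σ = σ} {τ} eq with ∷ʳ-injective (Vec.map (punchIn _) σ) _ eq
... | mapσ≡mapτ , refl = map-injective (punchIn-injective _ _ _) mapσ≡mapτ , refl

val-extend-< : ∀ {n} (σ : Vec (Fin n) n) j {i} → i < n → val (extend σ j) i ≡ punchℕ (toℕ j) (val σ i)
val-extend-< σ j i<n = trans (letter-∷ʳ-< (Vec.map (punchIn j) σ) j i<n) (letter-map-punchIn j σ i<n)

val-extend-last : ∀ {n} (σ : Vec (Fin n) n) j → val (extend σ j) n ≡ toℕ j
val-extend-last σ j = letter-∷ʳ-last (Vec.map (punchIn j) σ) j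

extend-sameOrder : ∀ {n} (σ : Vec (Fin n) n) j → SameOrderBelow n (val σ) (val (extend σ j))
extend-sameOrder σ j {i} {i′} i<n i′<n = mk⇔
  (λ σi<σi′ → subst₂ _<_ (sym (val-extend-< σ j i<n)) (sym (val-extend-< σ j i′<n))
                        (punchℕ-mono-< (toℕ j) σi<σi′))
  (λ πi<πi′ → punchℕ-cancel-< (toℕ j)
                (subst₂ _<_ (val-extend-< σ j i<n) (val-extend-< σ j i′<n) πi<πi′))

InjectiveBelow : ℕ → (ℕ → ℕ) → Set
InjectiveBelow n f = ∀ {i j} → i < n → j < n → f i ≡ f j → i ≡ j

isPerm⇔injectiveBelow : ∀ {n} (π : Vec (Fin n) n) → IsPerm π ⇔ InjectiveBelow n (val π)
isPerm⇔injectiveBelow π = mk⇔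
  (λ perm {i} {j} i<n j<n πi≡πj → fromℕ<-injective i j i<n j<n
     (perm _ _ (toℕ-injective (trans (sym (letter-fromℕ< π i<n)) (trans πi≡πj (letter-fromℕ< π j<n))))))
  (λ inj i j πi≡πj → toℕ-injective (inj (toℕ<n i) (toℕ<n j)
     (trans (letter-lookup π i) (trans (cong toℕ πi≡πj) (sym (letter-lookup π j))))))

extend-isPerm : ∀ {n} (σ : Vec (Fin n) n) j → IsPerm σ → IsPerm (extend σ j)
extend-isPerm {n} σ j σ-perm = from (isPerm⇔injectiveBelow (extend σ j)) inj
  where
  σ-inj = to (isPerm⇔injectiveBelow σ) σ-perm
  inj : InjectiveBelow (suc n) (val (extend σ j))
  inj i<1+n i′<1+n eq with m<1+n⇒m<n∨m≡n i<1+n | m<1+n⇒m<n∨m≡n i′<1+n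
  ... | inj₁ i<n | inj₁ i′<n = σ-inj i<n i′<n (punchℕ-injective (toℕ j)
          (trans (sym (val-extend-< σ j i<n)) (trans eq (val-extend-< σ j i′<n))))
  ... | inj₁ i<n | inj₂ refl = contradiction
          (trans (sym (val-extend-< σ j i<n)) (trans eq (val-extend-last σ j))) (punchℕ-≢ (toℕ j) _)
  ... | inj₂ refl | inj₁ i′<n = contradiction
          (trans (sym (val-extend-< σ j i′<n)) (trans (sym eq) (val-extend-last σ j))) (punchℕ-≢ (toℕ j) _)
  ... | inj₂ refl | inj₂ refl = refl

extend-isPerm⁻ : ∀ {n} (σ : Vec (Fin n) n) j → IsPerm (extend σ j) → IsPerm σ
extend-isPerm⁻ {n} σ j π-perm = from (isPerm⇔injectiveBelow σ) λ i<n i′<n σi≡σi′ →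
  to (isPerm⇔injectiveBelow (extend σ j)) π-perm (m<n⇒m<1+n i<n) (m<n⇒m<1+n i′<n)
    (trans (val-extend-< σ j i<n) (trans (cong (punchℕ (toℕ j)) σi≡σi′) (sym (val-extend-< σ j i′<n))))

extend-surjective : ∀ {n} (π : Vec (Fin (suc n)) (suc n)) → IsPerm π → ∃₂ λ σ j → extend σ j ≡ π
extend-surjective {n} π π-perm with initLast π
... | τ , y , refl = σ , y , cong (_∷ʳ y) punchIn-σ
  where
  y≢τ : ∀ i → y ≢ lookup τ i
  y≢τ i y≡τi = <-irrefl (sym (to (isPerm⇔injectiveBelow π) π-perm (n<1+n n) (m<n⇒m<1+n (toℕ<n i))
    (trans (letter-∷ʳ-last τ y) (trans (cong toℕ y≡τi)
      (trans (sym (letter-lookup τ i)) (sym (letter-∷ʳ-< τ y (toℕ<n i)))))))) (toℕ<n i)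
  σ : Vec (Fin n) n
  σ = Vec.tabulate (λ i → punchOut (y≢τ i))
  punchIn-σ : Vec.map (punchIn y) σ ≡ τ
  punchIn-σ = begin
    Vec.map (punchIn y) σ                             ≡⟨ tabulate-∘ (punchIn y) _ ⟨
    Vec.tabulate (λ i → punchIn y (punchOut (y≢τ i)))
      ≡⟨ tabulate-cong (λ i → punchIn-punchOut (y≢τ i)) ⟩
    Vec.tabulate (lookup τ)                           ≡⟨ tabulate∘lookup τ ⟩
    τ                                                 ∎
    where open ≡-Reasoning

allWords-suc : ∀ k l →
               allWords k (suc l) ≡ cartesianProductWith (λ w x → x ∷ w) (allWords k l) (allFin k)
allWords-suc k l = concatMap-map (allWords k l)
  where
  concatMap-map : ∀ ws → concatMap (λ w → map (_∷ w) (allFin k)) ws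
                         ≡ cartesianProductWith (λ w x → x ∷ w) ws (allFin k)
  concatMap-map []       = refl
  concatMap-map (w ∷ ws) = cong (map (_∷ w) (allFin k) ++_) (concatMap-map ws)

allWords-unique : ∀ k l → Unique (allWords k l)
allWords-unique k zero    = [] AllPairs.∷ AllPairs.[]
allWords-unique k (suc l) = subst Unique (sym (allWords-suc k l))
  (Unique.cartesianProductWith⁺ _ (λ eq → ∷-injectiveʳ eq , ∷-injectiveˡ eq)
                                  (allWords-unique k l) (Unique.allFin⁺ k))

∈-allWords : ∀ {k l} (w : Vec (Fin k) l) → w ∈ allWords k l
∈-allWords []      = here refl
∈-allWords {k} {suc l} (x ∷ w) = subst (x ∷ w ∈_) (sym (allWords-suc k l))
  (∈-cartesianProductWith⁺ (λ w x → x ∷ w) (∈-allWords w) (∈-allFin x))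

∈-perms⇔isPerm : ∀ {n} {π : Vec (Fin n) n} → π ∈ perms n ⇔ IsPerm π
∈-perms⇔isPerm {n} {π} =
  mk⇔ (proj₂ ∘ ∈-filter⁻ isPerm? {xs = allWords n n}) (∈-filter⁺ isPerm? (∈-allWords π))

perms-unique : ∀ n → Unique (perms n)
perms-unique n = Unique.filter⁺ isPerm? (allWords-unique n n)

perms-suc-↭ : ∀ n → perms (suc n) ↭ cartesianProductWith extend (perms n) (allFin (suc n))
perms-suc-↭ n = ∼bag⇒↭ (unique∧set⇒bag (perms-unique (suc n)) extensions-unique (mk⇔ decompose compose))
  where
  extensions-unique : Unique (cartesianProductWith extend (perms n) (allFin (suc n)))
  extensions-unique =
    Unique.cartesianProductWith⁺ extend extend-injective (perms-unique n) (Unique.allFin⁺ (suc n))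
  decompose : ∀ {π} → π ∈ perms (suc n) → π ∈ cartesianProductWith extend (perms n) (allFin (suc n))
  decompose {π} π∈ with π-perm ← to ∈-perms⇔isPerm π∈ | extend-surjective π π-perm
  ... | σ , j , refl =
    ∈-cartesianProductWith⁺ extend (from ∈-perms⇔isPerm (extend-isPerm⁻ σ j π-perm)) (∈-allFin j)
  compose : ∀ {π} → π ∈ cartesianProductWith extend (perms n) (allFin (suc n)) → π ∈ perms (suc n)
  compose π∈ with σ , j , σ∈ , _ , refl ← ∈-cartesianProductWith⁻ extend (perms n) (allFin (suc n)) π∈
    = from ∈-perms⇔isPerm (extend-isPerm σ j (to ∈-perms⇔isPerm σ∈))

count-≥-perm : ∀ {n} (σ : Vec (Fin n) n) → IsPerm σ → ∀ {j} → j ≤ n →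
               count (λ i → j ≤? val σ i) (upTo n) ≡ n ∸ j
count-≥-perm {zero}  _ _ {j} _ = sym (0∸n≡0 j)
count-≥-perm {suc n} π π-perm {j} j≤1+n with extend-surjective π π-perm
... | σ , k , refl = trans (count-upTo-suc (≤π? j) n) (split j j≤1+n (j ≤? toℕ k))
  where
  ≤π? : ∀ j → U.Decidable (λ i → j ≤ val (extend σ k) i)
  ≤π? j i = j ≤? val (extend σ k) i
  σ-perm : IsPerm σ
  σ-perm = extend-isPerm⁻ σ k π-perm
  k≤n : toℕ k ≤ n
  k≤n = s≤s⁻¹ (toℕ<n k)
  shift-threshold : ∀ {j j′} → (∀ x → j ≤ punchℕ (toℕ k) x ⇔ j′ ≤ x) →
                    count (≤π? j) (upTo n) ≡ count (λ i → j′ ≤? val σ i) (upTo n)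
  shift-threshold {j} punch⇔ = count-upTo-cong _ _ n λ {i} i<n →
    subst (λ πi → (j ≤ πi) ⇔ _) (sym (val-extend-< σ k i<n)) (punch⇔ (val σ i))
  split : ∀ j → j ≤ suc n → Dec (j ≤ toℕ k) →
          count (≤π? j) (upTo n) + count (≤π? j) [ n ] ≡ suc n ∸ j
  split j _ (yes j≤k) = begin
    _ ≡⟨ cong₂ _+_ (shift-threshold (λ x → ≤-punchℕ x j≤k))
                   (count-[x]-accept (≤π? j) (subst (j ≤_) (sym (val-extend-last σ k)) j≤k)) ⟩
    count (λ i → j ≤? val σ i) (upTo n) + 1 ≡⟨ cong (_+ 1) (count-≥-perm σ σ-perm j≤n) ⟩
    n ∸ j + 1                               ≡⟨ +-comm (n ∸ j) 1 ⟩
    suc (n ∸ j)                             ≡⟨ +-∸-assoc 1 j≤n ⟨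
    suc n ∸ j                               ∎
    where
    open ≡-Reasoning
    j≤n = ≤-trans j≤k k≤n
  split zero    _         (no j≰k) = contradiction z≤n j≰k
  split (suc j) 1+j≤1+n (no 1+j≰k) = begin
    _ ≡⟨ cong₂ _+_ (shift-threshold (λ x → <-punchℕ x (s≤s⁻¹ (≰⇒> 1+j≰k))))
                   (count-[x]-reject (≤π? (suc j))
                                     (subst (λ πn → ¬ suc j ≤ πn) (sym (val-extend-last σ k)) 1+j≰k)) ⟩
    count (λ i → j ≤? val σ i) (upTo n) + 0 ≡⟨ +-identityʳ _ ⟩
    count (λ i → j ≤? val σ i) (upTo n)     ≡⟨ count-≥-perm σ σ-perm (s≤s⁻¹ 1+j≤1+n) ⟩
    n ∸ j                                   ∎
    where open ≡-Reasoning

inv-extend : ∀ {n} (σ : Vec (Fin n) n) → IsPerm σ → ∀ j → inv (extend σ j) ≡ inv σ + (n ∸ toℕ j)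
inv-extend {n} σ σ-perm j = begin
  inv π                                                             ≡⟨ inv-inversions π ⟩
  inversions (val π) (suc n)                                        ≡⟨ inversions-suc (val π) n ⟩
  inversions (val π) n + count (λ i → val π n <? val π i) (upTo n)
    ≡⟨ cong₂ _+_ (inversions-cong n (extend-sameOrder σ j)) (count-upTo-cong _ _ n above-last⇔) ⟨
  inversions (val σ) n + count (λ i → toℕ j ≤? val σ i) (upTo n)
    ≡⟨ cong₂ _+_ (sym (inv-inversions σ)) (count-≥-perm σ σ-perm (s≤s⁻¹ (toℕ<n j))) ⟩
  inv σ + (n ∸ toℕ j)                                               ∎
  where
  open ≡-Reasoning
  π = extend σ j
  above-last⇔ : ∀ {i} → i < n → (toℕ j ≤ val σ i) ⇔ (val π n < val π i)
  above-last⇔ {i} i<n = subst₂ (λ πn πi → (toℕ j ≤ val σ i) ⇔ (πn < πi))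
    (sym (val-extend-last σ j)) (sym (val-extend-< σ j i<n)) (⇔-sym (<-punchℕ (val σ i) ≤-refl))

-- Segmented patterns

module PatternProperties (m : ℕ) (_≺_ : Rel (Fin m) 0ℓ) (_≺?_ : Decidable _≺_) where
  open Pattern m _≺_ _≺?_

  AvoidsOrQuasiAvoids : ∀ {n} → Vec (Fin n) n → Set
  AvoidsOrQuasiAvoids π = Avoids π ⊎ QuasiAvoids π

  avoidsOrQuasiAvoids? : ∀ {n} (π : Vec (Fin n) n) → Dec (AvoidsOrQuasiAvoids π)
  avoidsOrQuasiAvoids? π = avoids? π ⊎-dec quasiAvoids? π

  avoids⇒¬quasiAvoids : ∀ {n} {π : Vec (Fin n) n} → Avoids π → ¬ QuasiAvoids π
  avoids⇒¬quasiAvoids none (one , _) = 0≢1+n (trans (sym none) one)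

  short⇒avoids : ∀ {n} (π : Vec (Fin n) n) → n < m → Avoids π
  short⇒avoids π n<m = cong (λ k → count (occursAt? π) (upTo k)) (m≤n⇒m∸n≡0 n<m)

  occursAt-cong : ∀ {n n′} {σ : Vec (Fin n) n} {π : Vec (Fin n′) n′} {i} →
                  SameOrderBelow n (val σ) (val π) → i + m ≤ n → OccursAt σ i ⇔ OccursAt π i
  occursAt-cong {i = i} σ≅π i+m≤n = mk⇔
    (λ occ s t s≺t → to   (σ≅π (inWindow s) (inWindow t)) (occ s t s≺t))
    (λ occ s t s≺t → from (σ≅π (inWindow s) (inWindow t)) (occ s t s≺t))
    where
    inWindow : ∀ s → i + toℕ s < _
    inWindow s = <-≤-trans (+-monoʳ-< i (toℕ<n s)) i+m≤n

  occurrences-extend : ∀ {n} (σ : Vec (Fin n) n) j → m ≤ suc n →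
                       length (occurrences (extend σ j))
                       ≡ length (occurrences σ) + count (occursAt? (extend σ j)) [ suc n ∸ m ]
  occurrences-extend {n} σ j m≤1+n = begin
    count (occursAt? π) (upTo (suc (suc n) ∸ m))
      ≡⟨ cong (count (occursAt? π) ∘ upTo) (+-∸-assoc 1 m≤1+n) ⟩
    count (occursAt? π) (upTo (suc (suc n ∸ m)))  ≡⟨ count-upTo-suc (occursAt? π) (suc n ∸ m) ⟩
    count (occursAt? π) (upTo (suc n ∸ m)) + last
      ≡⟨ cong (_+ last) (count-upTo-cong (occursAt? σ) (occursAt? π) (suc n ∸ m) earlier⇔) ⟨
    count (occursAt? σ) (upTo (suc n ∸ m)) + last ∎
    where
    open ≡-Reasoning
    π = extend σ j
    last = count (occursAt? π) [ suc n ∸ m ]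
    earlier⇔ : ∀ {i} → i < suc n ∸ m → OccursAt σ i ⇔ OccursAt π i
    earlier⇔ {i} i<k = occursAt-cong {σ = σ} {π = π} (extend-sameOrder σ j)
      (s≤s⁻¹ (subst (i + m <_) (m∸n+n≡m m≤1+n) (+-monoˡ-< m i<k)))

  avoids⇔extend-avoidsOrQuasiAvoids : ∀ {n} (σ : Vec (Fin n) n) j →
                                      Avoids σ ⇔ AvoidsOrQuasiAvoids (extend σ j)
  avoids⇔extend-avoidsOrQuasiAvoids {n} σ j with m ≤? suc n
  ... | no  m≰1+n = mk⇔ (λ _ → inj₁ (short⇒avoids (extend σ j) (≰⇒> m≰1+n)))
                        (λ _ → short⇒avoids σ (<-trans (n<1+n n) (≰⇒> m≰1+n)))
  ... | yes m≤1+n with occursAt? (extend σ j) (suc n ∸ m)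
  ...   | yes occ = mk⇔ (λ none → inj₂ (trans #π (cong (_+ 1) none) , m≤1+n , occ))
                        λ { (inj₁ none) → contradiction (m+n≡0⇒n≡0 #σ (trans (sym #π) none)) λ ()
                          ; (inj₂ (one , _)) → +-cancelʳ-≡ 1 #σ 0 (trans (sym #π) one) }
    where
    #σ = length (occurrences σ)
    #π = trans (occurrences-extend σ j m≤1+n) (cong (#σ +_) (count-[x]-accept (occursAt? (extend σ j)) occ))
  ...   | no ¬occ = mk⇔ (λ none → inj₁ (trans #π (cong (_+ 0) none)))
                        λ { (inj₁ none) → m+n≡0⇒m≡0 #σ (trans (sym #π) none)
                          ; (inj₂ (_ , _ , occ)) → contradiction occ ¬occ }
    where
    #σ = length (occurrences σ)
    #π = trans (occurrences-extend σ j m≤1+n) (cong (#σ +_) (count-[x]-reject (occursAt? (extend σ j)) ¬occ))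

-- For m = 0 the empty pattern occurs in the empty permutation, at position 0 = 0 ∸ m.
[]-avoidsOrQuasiAvoids : ∀ m (_≺_ : Rel (Fin m) 0ℓ) (_≺?_ : Decidable _≺_) →
                         PatternProperties.AvoidsOrQuasiAvoids m _≺_ _≺?_ []
[]-avoidsOrQuasiAvoids zero    _≺_ _≺?_ = inj₂ (refl , z≤n , λ ())
[]-avoidsOrQuasiAvoids (suc m) _≺_ _≺?_ =
  inj₁ (PatternProperties.short⇒avoids (suc m) _≺_ _≺?_ [] (s≤s z≤n))

module RingSum {c ℓ} (R : CommutativeRing c ℓ) where
  open CommutativeRing R
    using (Carrier; _≈_; 0#; _-_; setoid; isEquivalence; +-isCommutativeMonoid; +-group;
           distribˡ; distribʳ; zeroˡ; zeroʳ)
    renaming (_+_ to _⊕_; _*_ to _⊛_; sym to ≈-sym; trans to ≈-trans; +-cong to ⊕-cong;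
              +-congˡ to ⊕-congˡ; +-congʳ to ⊕-congʳ; +-identityˡ to ⊕-identityˡ; +-assoc to ⊕-assoc)
  open import Relation.Binary.Reasoning.Setoid setoid

  ∑ : List Carrier → Carrier
  ∑ = List.foldr _⊕_ 0#

  ∑-↭ : ∀ {xs ys} → xs ↭ ys → ∑ xs ≈ ∑ ys
  ∑-↭ xs↭ys = foldr-commMonoid setoid +-isCommutativeMonoid (↭⇒↭ₛ′ isEquivalence xs↭ys)

  ∑-++ : ∀ xs ys → ∑ (xs ++ ys) ≈ ∑ xs ⊕ ∑ ys
  ∑-++ []       ys = ≈-sym (⊕-identityˡ _)
  ∑-++ (x ∷ xs) ys = ≈-trans (⊕-congˡ (∑-++ xs ys)) (≈-sym (⊕-assoc x _ _))

  ∑-map-cartesianProductWith : ∀ (h : C → Carrier) (g : A → B → C) (u : A → Carrier) (v : B → Carrier)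
                               {xs} ys →
                               All (λ x → ∀ y → h (g x y) ≈ u x ⊛ v y) xs →
                               ∑ (map h (cartesianProductWith g xs ys)) ≈ ∑ (map u xs) ⊛ ∑ (map v ys)
  ∑-map-cartesianProductWith h g u v ys []                 = ≈-sym (zeroˡ _)
  ∑-map-cartesianProductWith h g u v {x ∷ xs} ys (hx ∷ hxs) = begin
    ∑ (map h (map (g x) ys ++ cartesianProductWith g xs ys))
      ≡⟨ cong ∑ (map-++ h (map (g x) ys) _) ⟩
    ∑ (map h (map (g x) ys) ++ map h (cartesianProductWith g xs ys))
      ≈⟨ ∑-++ (map h (map (g x) ys)) _ ⟩
    ∑ (map h (map (g x) ys)) ⊕ ∑ (map h (cartesianProductWith g xs ys))
      ≈⟨ ⊕-cong (row ys) (∑-map-cartesianProductWith h g u v ys hxs) ⟩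
    u x ⊛ ∑ (map v ys) ⊕ ∑ (map u xs) ⊛ ∑ (map v ys)
      ≈⟨ distribʳ _ _ _ ⟨
    (u x ⊕ ∑ (map u xs)) ⊛ ∑ (map v ys) ∎
    where
    row : ∀ ys → ∑ (map h (map (g x) ys)) ≈ u x ⊛ ∑ (map v ys)
    row []       = ≈-sym (zeroʳ _)
    row (y ∷ ys) = ≈-trans (⊕-cong (hx y) (row ys)) (≈-sym (distribˡ _ _ _))

  y≈z-x : ∀ {x y z} → y ⊕ x ≈ z → y ≈ z - x
  y≈z-x {x} {y} y⊕x≈z = ≈-trans (≈-sym (//-rightDividesʳ x y)) (⊕-congʳ y⊕x≈z)
    where open import Algebra.Properties.Group +-group using (//-rightDividesʳ)

-- The coefficients a and b

module _ (m : ℕ) (_≺_ : Rel (Fin m) 0ℓ) (_≺?_ : Decidable _≺_)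
         {c ℓ} (R : CommutativeRing c ℓ) (q : CommutativeRing.Carrier R) where
  open Pattern m _≺_ _≺?_
  open PatternProperties m _≺_ _≺?_
  open Pattern.Coefficients m _≺_ _≺?_ R q
  open RingSum R using (∑-↭; ∑-++; ∑-map-cartesianProductWith)
  open CommutativeRing R
    using (Carrier; _≈_; 0#; 1#; reflexive)
    renaming (_+_ to _⊕_; _*_ to _⊛_; refl to ≈-refl; sym to ≈-sym; trans to ≈-trans;
              +-congˡ to ⊕-congˡ; +-identityʳ to ⊕-identityʳ; +-comm to ⊕-comm;
              *-congˡ to ⊛-congˡ; *-assoc to ⊛-assoc; *-identityˡ to ⊛-identityˡ; *-comm to ⊛-comm)
  open import Relation.Binary.Reasoning.Setoid (CommutativeRing.setoid R)

  weight : ∀ {n} → Vec (Fin n) n → Carrier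
  weight π = pow q (inv π)

  pow-+ : ∀ i j → pow q (i + j) ≈ pow q i ⊛ pow q j
  pow-+ zero    j = ≈-sym (⊛-identityˡ _)
  pow-+ (suc i) j = ≈-trans (⊛-congˡ (pow-+ i j)) (≈-sym (⊛-assoc q _ _))

  qInt-suc : ∀ n → qInt (suc n) ≈ qInt n ⊕ pow q n
  qInt-suc n = begin
    sumR (map (pow q) (upTo (suc n)))          ≡⟨ cong (sumR ∘ map (pow q)) (upTo-∷ʳ n) ⟨
    sumR (map (pow q) (upTo n ++ [ n ]))       ≡⟨ cong sumR (map-++ (pow q) (upTo n) [ n ]) ⟩
    sumR (map (pow q) (upTo n) ++ [ pow q n ]) ≈⟨ ∑-++ (map (pow q) (upTo n)) _ ⟩
    qInt n ⊕ (pow q n ⊕ 0#)                    ≈⟨ ⊕-congˡ (⊕-identityʳ _) ⟩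
    qInt n ⊕ pow q n                           ∎

  ∑-pow-∸ : ∀ n → sumR (List.tabulate {n = suc n} (λ j → pow q (n ∸ toℕ j))) ≈ qInt (suc n)
  ∑-pow-∸ zero    = ≈-refl
  ∑-pow-∸ (suc n) = begin
    pow q (suc n) ⊕ sumR (List.tabulate {n = suc n} (λ j → pow q (n ∸ toℕ j)))
      ≈⟨ ⊕-congˡ (∑-pow-∸ n) ⟩
    pow q (suc n) ⊕ qInt (suc n) ≈⟨ ⊕-comm _ _ ⟩
    qInt (suc n) ⊕ pow q (suc n) ≈⟨ qInt-suc (suc n) ⟨
    qInt (suc (suc n))           ∎

  b+a≈∑avoidsOrQuasiAvoids : ∀ n → b n ⊕ a n ≈ sumR (map weight (filter avoidsOrQuasiAvoids? (perms n)))
  b+a≈∑avoidsOrQuasiAvoids n = begin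
    b n ⊕ a n                                 ≈⟨ ⊕-comm _ _ ⟩
    a n ⊕ b n                                 ≈⟨ ∑-++ (map weight (filter avoids? (perms n))) _ ⟨
    sumR (map weight (filter avoids? (perms n)) ++ map weight (filter quasiAvoids? (perms n)))
      ≡⟨ cong sumR (map-++ weight (filter avoids? (perms n)) _) ⟨
    sumR (map weight (filter avoids? (perms n) ++ filter quasiAvoids? (perms n)))
      ≈⟨ ∑-↭ (map⁺ weight (filter-⊎-↭ avoids? quasiAvoids? (λ {π} → avoids⇒¬quasiAvoids {π = π})
                                       (perms n))) ⟨
    sumR (map weight (filter avoidsOrQuasiAvoids? (perms n))) ∎

  b₀+a₀≈1 : b 0 ⊕ a 0 ≈ 1#
  b₀+a₀≈1 = begin
    b 0 ⊕ a 0                                                      ≈⟨ b+a≈∑avoidsOrQuasiAvoids 0 ⟩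
    sumR (map weight (filter avoidsOrQuasiAvoids? ([] ∷ [])))
      ≡⟨ cong (sumR ∘ map weight)
              (filter-accept avoidsOrQuasiAvoids? ([]-avoidsOrQuasiAvoids m _≺_ _≺?_)) ⟩
    1# ⊕ 0#                                                        ≈⟨ ⊕-identityʳ 1# ⟩
    1#                                                             ∎

  b+a≈qInt*a : ∀ n → b (suc n) ⊕ a (suc n) ≈ qInt (suc n) ⊛ a n
  b+a≈qInt*a n = begin
    b (suc n) ⊕ a (suc n)
      ≈⟨ b+a≈∑avoidsOrQuasiAvoids (suc n) ⟩
    sumR (map weight (filter avoidsOrQuasiAvoids? (perms (suc n))))
      ≈⟨ ∑-↭ (map⁺ weight (filter-↭ avoidsOrQuasiAvoids? (perms-suc-↭ n))) ⟩
    sumR (map weight (filter avoidsOrQuasiAvoids? (cartesianProductWith extend (perms n) (allFin (suc n)))))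
      ≡⟨ cong (sumR ∘ map weight) (filter-cartesianProductWith avoidsOrQuasiAvoids? avoids? extend
                                     avoids⇔extend-avoidsOrQuasiAvoids (perms n) (allFin (suc n))) ⟩
    sumR (map weight (cartesianProductWith extend (filter avoids? (perms n)) (allFin (suc n))))
      ≈⟨ ∑-map-cartesianProductWith weight extend weight qⁿ⁻ʲ (allFin (suc n)) weight-extend ⟩
    a n ⊛ sumR (map qⁿ⁻ʲ (allFin (suc n)))
      ≡⟨ cong (λ xs → a n ⊛ sumR xs) (map-tabulate id qⁿ⁻ʲ) ⟩
    a n ⊛ sumR (List.tabulate qⁿ⁻ʲ)
      ≈⟨ ⊛-congˡ (∑-pow-∸ n) ⟩
    a n ⊛ qInt (suc n)
      ≈⟨ ⊛-comm _ _ ⟩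
    qInt (suc n) ⊛ a n ∎
    where
    qⁿ⁻ʲ : Fin (suc n) → Carrier
    qⁿ⁻ʲ j = pow q (n ∸ toℕ j)
    weight-extend : All (λ σ → ∀ j → weight (extend σ j) ≈ weight σ ⊛ qⁿ⁻ʲ j)
                        (filter avoids? (perms n))
    weight-extend = All⁺.filter⁺ avoids? (All.map {P = IsPerm}
      (λ {σ} σ-perm j → ≈-trans (reflexive (cong (pow q) (inv-extend σ σ-perm j))) (pow-+ (inv σ) _))
      (All⁺.all-filter isPerm? (allWords n n)))

-- The identity holds for every decidable relation _≺_.
mainTheorem12 : ∀ {c ℓ} (R : CommutativeRing c ℓ) (q : CommutativeRing.Carrier R)
  (m : ℕ) (_≺_ : Rel (Fin m) 0ℓ) → IsStrictPartialOrder _≡_ _≺_ → (_≺?_ : Decidable _≺_) →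
  let open CommutativeRing R
      open Pattern.Coefficients m _≺_ _≺?_ R q
  in (b 0 ≈ 1# - a 0)
     × (∀ n → b (suc n) ≈ qInt (suc n) * a n - a (suc n))
mainTheorem12 R q m _≺_ _ _≺?_ =
  RingSum.y≈z-x R (b₀+a₀≈1 m _≺_ _≺?_ R q) , λ n → RingSum.y≈z-x R (b+a≈qInt*a m _≺_ _≺?_ R q n)
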